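{- Let $L$ be a finite simple graph, $C$ a longest cycle of $L$ with a fixed orientation, and $x\in V(L)\setminus V(C)$ a vertex all of whose neighbours lie on $C$; let $x_1,\dots,x_d$ be the neighbours of $x$ in the order in which they appear along $C$. Let $i\neq j$ and suppose $w$ and $w^+$ both lie on the path $x_i\overrightarrow{C}x_j$. Then it is not the case that both $wx_i^-$ and $w^+x_j^+$ are edges of $L$, and it is not the case that both $wx_j^+$ and $w^+x_i^-$ are edges of $L$.
   Context: For a vertex $y$ on the oriented cycle $C$, $y^+$ and $y^-$ denote the successor and predecessor of $y$ on $C$. For $u,v\in V(C)$, $u\overrightarrow{C}v$ denotes the path in $C$ from $u$ to $v$ following the orientation of $C$. -}

module Defs where

open import Data.Nat using (ℕ; zero; suc; _+_; _∸_; _≤_; _%_)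
open import Data.Nat.DivMod using (m%n<n)
open import Data.Fin using (Fin; toℕ; fromℕ<)
open import Data.Product using (Σ; ∃; _×_)
open import Relation.Binary.PropositionalEquality using (_≡_)
open import Relation.Nullary using (¬_)
open import Function.Definitions using (Injective)

record Graph (n : ℕ) : Set₁ where
  field
    Adj    : Fin n → Fin n → Set
    sym    : ∀ {u v} → Adj u v → Adj v u
    irrefl : ∀ {u} → ¬ Adj u u
open Graph public

idx : ∀ {k} → ℕ → Fin (suc k)
idx {k} t = fromℕ< (m%n<n t (suc k))

next : ∀ {k} → Fin (suc k) → Fin (suc k)
next i = idx (suc (toℕ i))

prev : ∀ {k} → Fin (suc k) → Fin (suc k)
prev {k} i = idx (toℕ i + k)

-- An oriented cycle of G: distinct vertices vtx 0, ..., vtx k (k ≥ 2, so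
-- length ≥ 3), with vtx i adjacent to vtx (i+1 mod (k+1)).  The orientation
-- is the order of the positions.
record Cycle {n : ℕ} (G : Graph n) : Set where
  field
    k    : ℕ
    2≤k  : 2 ≤ k
    vtx  : Fin (suc k) → Fin n
    inj  : Injective _≡_ _≡_ vtx
    adj  : ∀ i → Adj G (vtx i) (vtx (next i))
open Cycle public

len : ∀ {n} {G : Graph n} → Cycle G → ℕ
len C = suc (k C)

Longest : ∀ {n} (G : Graph n) → Cycle G → Set
Longest G C = ∀ (D : Cycle G) → len D ≤ len C

OnCycle : ∀ {n} {G : Graph n} → Cycle G → Fin n → Set
OnCycle C y = ∃ λ i → vtx C i ≡ y

dist : ∀ {k} → Fin (suc k) → Fin (suc k) → ℕ
dist {k} a b = (toℕ b + suc k ∸ toℕ a) % suc k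

OnPath : ∀ {k} → Fin (suc k) → Fin (suc k) → Fin (suc k) → Set
OnPath a b s = ∃ λ t → (t ≤ dist a b) × (s ≡ idx (toℕ a + t))

{-# OPTIONS --safe #-}
-- Read C from a = x_i, writing f u for the vertex u steps further on: f 0 = a,
-- f d = b = x_j, f K = a⁻ and s = w = f e with e < d.  If d = K, then x fits between
-- a⁻ and a.  Otherwise each pair of chords reroutes C through x:
--   s ~ a⁻ and s⁺ ~ b⁺ give  x, f 0 … f e, f K … f (d+1), f (e+1) … f d;
--   s ~ b⁺ and s⁺ ~ a⁻ give  x, f 0 … f e, f (d+1) … f K, f (e+1) … f d.
-- Each closed walk lists the vertices of C and x in some order, so its vertices are
-- distinct, and it is a cycle longer than C.
module Submission where

open import Defs renaming (sym to Adj-sym)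
open import Data.Nat using (ℕ; zero; suc; _+_; _∸_; _%_; _≤_; _<_; s≤s; NonZero)
open import Data.Nat.Properties
  using ( suc-injective; +-suc; +-identityʳ; +-assoc; +-comm; +-∸-assoc; m+[n∸m]≡n; m≤n+m
        ; ≤-pred; ≤-trans; ≤-reflexive; <⇒≤; <⇒≢; <⇒≱; <-trans; ≤∧≢⇒<; m≤n⇒m<n∨m≡n
        ; m≤n⇒∃[o]m+o≡n )
open import Data.Nat.DivMod using (%-distribˡ-+; m%n%n≡m%n; [m+n]%n≡m%n; m<n⇒m%n≡m; n%n≡0; m%n<n)
open import Data.Nat.Tactic.RingSolver using (solve-∀)
open import Data.Fin using (Fin; zero; suc; toℕ)
open import Data.Fin.Properties using (toℕ-injective; toℕ-fromℕ<; toℕ<n)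
open import Data.List using (List; []; _∷_; [_]; _++_; applyUpTo; applyDownFrom; head; last; lookup; length)
open import Data.List.Properties using (reverse-applyUpTo; ++-assoc; length-applyUpTo)
import Data.List.Relation.Unary.All as All
import Data.List.Relation.Unary.All.Properties as All
open import Data.List.Relation.Unary.AllPairs using (_∷_)
open import Data.List.Relation.Unary.Linked using (Linked; _∷_)
import Data.List.Relation.Unary.Linked.Properties as Linked
open import Data.List.Relation.Unary.Unique.Propositional using (Unique)
import Data.List.Relation.Unary.Unique.Propositional.Properties as Unique
open import Data.List.Membership.Propositional.Properties using (∈-lookup)
open import Data.List.Relation.Binary.Permutation.Propositional
  using (_↭_; ↭-refl; ↭-sym; prep; ↭⇒↭ₛ; module PermutationReasoning)
open import Data.List.Relation.Binary.Permutation.Propositional.Properties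
  using (↭-reverse; ↭-length; ++⁺ˡ; ++⁺ʳ; ++-comm)
open import Data.List.Relation.Binary.Permutation.Setoid.Properties using (Unique-resp-↭)
open import Data.Maybe using (just)
open import Data.Maybe.Relation.Binary.Connected using (Connected; just)
open import Data.Product using (_×_; _,_)
open import Data.Sum using (inj₁; inj₂)
open import Data.Empty using (⊥-elim)
open import Function using (_∘_)
open import Level using (_⊔_)
open import Relation.Binary.Core using (Rel)
open import Relation.Binary.Definitions using (Symmetric)
open import Relation.Binary.PropositionalEquality
  using (_≡_; _≢_; refl; sym; trans; cong; cong₂; subst; subst₂; setoid; module ≡-Reasoning)
open import Relation.Nullary using (¬_)

module _ {a} {A : Set a} where

  Unique⇒lookup-injective : ∀ {xs : List A} → Unique xs → ∀ {i j} → lookup xs i ≡ lookup xs j → i ≡ j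
  Unique⇒lookup-injective (_ ∷ _)    {zero}  {zero}  _  = refl
  Unique⇒lookup-injective (x∉xs ∷ _) {zero}  {suc j} eq = ⊥-elim (All.lookup x∉xs (∈-lookup j) eq)
  Unique⇒lookup-injective (x∉xs ∷ _) {suc i} {zero}  eq = ⊥-elim (All.lookup x∉xs (∈-lookup i) (sym eq))
  Unique⇒lookup-injective (_ ∷ u)    {suc i} {suc j} eq = cong suc (Unique⇒lookup-injective u eq)

  last-lookup : ∀ {xs : List A} (i : Fin (length xs)) → suc (toℕ i) ≡ length xs →
    last xs ≡ just (lookup xs i)
  last-lookup {_ ∷ []}    zero    _  = refl
  last-lookup {_ ∷ _ ∷ _} (suc i) eq = last-lookup i (suc-injective eq)

  last-++ : ∀ (xs : List A) {y ys} → last (xs ++ y ∷ ys) ≡ last (y ∷ ys)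
  last-++ []           = refl
  last-++ (_ ∷ [])     = refl
  last-++ (_ ∷ x ∷ xs) = last-++ (x ∷ xs)

  head-++ : ∀ {xs : List A} {u} ys → head xs ≡ just u → head (xs ++ ys) ≡ just u
  head-++ {_ ∷ _} _ p = p

  last-applyUpTo : ∀ (f : ℕ → A) n → last (applyUpTo f (suc n)) ≡ just (f n)
  last-applyUpTo f zero    = refl
  last-applyUpTo f (suc n) = last-applyUpTo (f ∘ suc) n

  last-applyDownFrom : ∀ (f : ℕ → A) n → last (applyDownFrom f (suc n)) ≡ just (f 0)
  last-applyDownFrom f zero    = refl
  last-applyDownFrom f (suc n) = last-applyDownFrom f n

  applyUpTo-cong : ∀ {f g : ℕ → A} → (∀ i → f i ≡ g i) → ∀ n → applyUpTo f n ≡ applyUpTo g n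
  applyUpTo-cong f≗g zero    = refl
  applyUpTo-cong f≗g (suc n) = cong₂ _∷_ (f≗g 0) (applyUpTo-cong (f≗g ∘ suc) n)

  applyUpTo-++ : ∀ (f : ℕ → A) m n →
    applyUpTo f (m + n) ≡ applyUpTo f m ++ applyUpTo (λ i → f (m + i)) n
  applyUpTo-++ f zero    n = refl
  applyUpTo-++ f (suc m) n = cong (f 0 ∷_) (applyUpTo-++ (f ∘ suc) m n)

  module _ {ℓ} {R : Rel A ℓ} where

    Linked⇒lookup-suc : ∀ {xs} → Linked R xs → (i j : Fin (length xs)) → toℕ j ≡ suc (toℕ i) →
      R (lookup xs i) (lookup xs j)
    Linked⇒lookup-suc (r ∷ _)  zero    (suc zero) _  = r
    Linked⇒lookup-suc (_ ∷ rs) (suc i) (suc j)    eq = Linked⇒lookup-suc rs i j (suc-injective eq)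

    connected : ∀ xs ys {u v} → last xs ≡ just u → head ys ≡ just v → R u v →
      Connected R (last xs) (head ys)
    connected _ _ p q r rewrite p | q = just r

    join : ∀ {xs ys u v} → Linked R xs → last xs ≡ just u → R u v → head ys ≡ just v → Linked R ys →
      Linked R (xs ++ ys)
    join {xs} {ys} lxs p r q lys = Linked.++⁺ lxs (connected xs ys p q r) lys

arc : ∀ {a} {A : Set a} → (ℕ → A) → ℕ → ℕ → List A
arc f u n = applyUpTo (λ i → f (u + i)) n

arc⁻ : ∀ {a} {A : Set a} → (ℕ → A) → ℕ → ℕ → List A
arc⁻ f u n = applyDownFrom (λ i → f (u + i)) n

module _ {a} {A : Set a} (f : ℕ → A) where

  arc-++ : ∀ u m n → arc f u (m + n) ≡ arc f u m ++ arc f (u + m) n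
  arc-++ u m n = trans (applyUpTo-++ _ m n)
    (cong (arc f u m ++_) (applyUpTo-cong (λ i → cong f (sym (+-assoc u m i))) n))

  arc⁻↭arc : ∀ u n → arc⁻ f u n ↭ arc f u n
  arc⁻↭arc u n = subst (_↭ arc f u n) (reverse-applyUpTo _ n) (↭-reverse (arc f u n))

  head-arc : ∀ u n → head (arc f u (suc n)) ≡ just (f u)
  head-arc u n = cong (just ∘ f) (+-identityʳ u)

  last-arc : ∀ u n → last (arc f u (suc n)) ≡ just (f (u + n))
  last-arc u n = last-applyUpTo (λ i → f (u + i)) n

  last-arc⁻ : ∀ u n → last (arc⁻ f u (suc n)) ≡ just (f u)
  last-arc⁻ u n = trans (last-applyDownFrom _ n) (cong (just ∘ f) (+-identityʳ u))

  module _ {ℓ} {R : Rel A ℓ} (step : ∀ u → R (f u) (f (suc u))) where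

    shifted-step : ∀ u i → R (f (u + i)) (f (u + suc i))
    shifted-step u i = subst (R (f (u + i))) (cong f (sym (+-suc u i))) (step (u + i))

    Linked-arc : ∀ u n → Linked R (arc f u n)
    Linked-arc u n = Linked.applyUpTo⁺₂ _ n (shifted-step u)

    Linked-arc⁻ : Symmetric R → ∀ u n → Linked R (arc⁻ f u n)
    Linked-arc⁻ R-sym u n = Linked.applyDownFrom⁺₂ _ n (R-sym ∘ shifted-step u)

record HamiltonianCycle {a ℓ} {A : Set a} (R : Rel A ℓ) (vs : List A) : Set (a ⊔ ℓ) where
  field
    order  : List A
    order↭ : order ↭ vs
    linked : Linked R order
    closed : Connected R (last order) (head order)

module Rerouting {a ℓ} {A : Set a} {R : Rel A ℓ} (R-sym : Symmetric R)
  (f : ℕ → A) (step : ∀ u → R (f u) (f (suc u))) {x : A} (x~f₀ : R x (f 0)) where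

  insertion : ∀ {K} → R x (f K) → HamiltonianCycle R (x ∷ arc f 0 (suc K))
  insertion {K} x~fK = record
    { order  = x ∷ arc f 0 (suc K)
    ; order↭ = ↭-refl
    ; linked = x~f₀ ∷ Linked-arc f step 0 (suc K)
    ; closed = connected (arc f 0 (suc K)) [ x ] (last-arc f 0 K) refl (R-sym x~fK)
    }

  private
    module Pieces (e c r : ℕ) where

      d K : ℕ
      d = suc e + c
      K = suc d + r

      front middle back : List A
      front  = arc f 0 (suc e)
      middle = arc f (suc e) (suc c)
      back   = arc f (suc d) (suc r)

      arc-split : arc f 0 (suc K) ≡ front ++ middle ++ back
      arc-split = begin
        arc f 0 (suc K)
          ≡⟨ cong (arc f 0) (lengths e c r) ⟩
        arc f 0 (suc e + (suc c + suc r))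
          ≡⟨ arc-++ f 0 (suc e) _ ⟩
        front ++ arc f (suc e) (suc c + suc r)
          ≡⟨ cong (front ++_) (arc-++ f (suc e) (suc c) (suc r)) ⟩
        front ++ middle ++ arc f (suc e + suc c) (suc r)
          ≡⟨ cong (λ u → front ++ middle ++ arc f u (suc r)) (+-suc (suc e) c) ⟩
        front ++ middle ++ back
          ∎
        where
        open ≡-Reasoning
        lengths : ∀ e c r → suc (suc (suc e + c) + r) ≡ suc e + (suc c + suc r)
        lengths = solve-∀

      last-middle : ∀ ys → last (front ++ ys ++ middle) ≡ just (f d)
      last-middle ys = trans (cong last (sym (++-assoc front ys middle)))
                             (trans (last-++ (front ++ ys)) (last-arc f (suc e) c))

      detour : ∀ {ys h l} → ys ↭ back → Linked R ys → head ys ≡ just h → last ys ≡ just l →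
        R (f e) h → R l (f (suc e)) → R x (f d) → HamiltonianCycle R (x ∷ arc f 0 (suc K))
      detour {ys} ys↭back linked-ys head-ys last-ys fe~h l~fe⁺ x~fd = record
        { order  = x ∷ front ++ ys ++ middle
        ; order↭ = prep x (begin
            front ++ ys ++ middle    ↭⟨ ++⁺ˡ front (++⁺ʳ middle ys↭back) ⟩
            front ++ back ++ middle  ↭⟨ ++⁺ˡ front (++-comm back middle) ⟩
            front ++ middle ++ back  ≡⟨ arc-split ⟨
            arc f 0 (suc K)          ∎)
        ; linked = x~f₀ ∷ join (Linked-arc f step 0 (suc e)) (last-arc f 0 e) fe~h (head-++ middle head-ys)
                       (join linked-ys last-ys l~fe⁺ (head-arc f (suc e) c) (Linked-arc f step (suc e) (suc c)))
        ; closed = connected (front ++ ys ++ middle) [ x ] (last-middle ys) refl (R-sym x~fd)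
        }
        where open PermutationReasoning

  reversing : ∀ {e d K} → e < d → d < K → R x (f d) → R (f e) (f K) → R (f (suc e)) (f (suc d)) →
    HamiltonianCycle R (x ∷ arc f 0 (suc K))
  reversing {e} e<d d<K x~fd fe~fK fe⁺~fd⁺ with m≤n⇒∃[o]m+o≡n e<d
  ... | c , refl with m≤n⇒∃[o]m+o≡n d<K
  ... | r , refl = detour (arc⁻↭arc f (suc d) (suc r)) (Linked-arc⁻ f step R-sym (suc d) (suc r))
                     refl (last-arc⁻ f (suc d) r) fe~fK (R-sym fe⁺~fd⁺) x~fd
    where open Pieces e c r

  swapping : ∀ {e d K} → e < d → d < K → R x (f d) → R (f e) (f (suc d)) → R (f (suc e)) (f K) →
    HamiltonianCycle R (x ∷ arc f 0 (suc K))
  swapping {e} e<d d<K x~fd fe~fd⁺ fe⁺~fK with m≤n⇒∃[o]m+o≡n e<d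
  ... | c , refl with m≤n⇒∃[o]m+o≡n d<K
  ... | r , refl = detour ↭-refl (Linked-arc f step (suc d) (suc r))
                     (head-arc f (suc d) r) (last-arc f (suc d) r) fe~fd⁺ (R-sym fe⁺~fK) x~fd
    where open Pieces e c r

[m%d+n]%d≡[m+n]%d : ∀ m n d .{{_ : NonZero d}} → (m % d + n) % d ≡ (m + n) % d
[m%d+n]%d≡[m+n]%d m n d = begin
  (m % d + n) % d            ≡⟨ %-distribˡ-+ (m % d) n d ⟩
  (m % d % d + n % d) % d    ≡⟨ cong (λ t → (t + n % d) % d) (m%n%n≡m%n m d) ⟩
  (m % d + n % d) % d        ≡⟨ %-distribˡ-+ m n d ⟨
  (m + n) % d                ∎
  where open ≡-Reasoning

toℕ-idx : ∀ {k} t → toℕ (idx {k} t) ≡ t % suc k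
toℕ-idx {k} t = toℕ-fromℕ< (m%n<n t (suc k))

infixl 6 _⊕_

_⊕_ : ∀ {k} → Fin (suc k) → ℕ → Fin (suc k)
a ⊕ u = idx (toℕ a + u)

module _ {k} (a : Fin (suc k)) where

  private
    M p : ℕ
    M = suc k
    p = toℕ a

  ⊕-zero : a ⊕ 0 ≡ a
  ⊕-zero = toℕ-injective (trans (toℕ-idx {k} (p + 0))
    (trans (cong (_% M) (+-identityʳ p)) (m<n⇒m%n≡m (toℕ<n a))))

  next-⊕ : ∀ u → next (a ⊕ u) ≡ a ⊕ suc u
  next-⊕ u = toℕ-injective (begin
    toℕ (next (a ⊕ u))      ≡⟨ toℕ-idx {k} (suc (toℕ (a ⊕ u))) ⟩
    suc (toℕ (a ⊕ u)) % M   ≡⟨ cong (λ t → suc t % M) (toℕ-idx {k} (p + u)) ⟩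
    suc ((p + u) % M) % M   ≡⟨ cong (_% M) (+-comm 1 _) ⟩
    ((p + u) % M + 1) % M   ≡⟨ [m%d+n]%d≡[m+n]%d (p + u) 1 M ⟩
    (p + u + 1) % M         ≡⟨ cong (_% M) (trans (+-assoc p u 1) (cong (p +_) (+-comm u 1))) ⟩
    (p + suc u) % M         ≡⟨ toℕ-idx {k} (p + suc u) ⟨
    toℕ (a ⊕ suc u)         ∎)
    where open ≡-Reasoning

  dist-⊕ : ∀ {u} → u < M → dist a (a ⊕ u) ≡ u
  dist-⊕ {u} u<M = begin
    (toℕ (a ⊕ u) + M ∸ p) % M     ≡⟨ cong (λ t → (t + M ∸ p) % M) (toℕ-idx {k} (p + u)) ⟩
    ((p + u) % M + M ∸ p) % M     ≡⟨ cong (_% M) (+-∸-assoc ((p + u) % M) p≤M) ⟩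
    ((p + u) % M + (M ∸ p)) % M   ≡⟨ [m%d+n]%d≡[m+n]%d (p + u) (M ∸ p) M ⟩
    (p + u + (M ∸ p)) % M         ≡⟨ cong (λ t → (t + (M ∸ p)) % M) (+-comm p u) ⟩
    (u + p + (M ∸ p)) % M         ≡⟨ cong (_% M) (trans (+-assoc u p _) (cong (u +_) (m+[n∸m]≡n p≤M))) ⟩
    (u + M) % M                   ≡⟨ [m+n]%n≡m%n u M ⟩
    u % M                         ≡⟨ m<n⇒m%n≡m u<M ⟩
    u                             ∎
    where
    open ≡-Reasoning
    p≤M : p ≤ M
    p≤M = <⇒≤ (toℕ<n a)

  ⊕-dist : ∀ b → a ⊕ dist a b ≡ b
  ⊕-dist b = toℕ-injective (begin
    toℕ (a ⊕ dist a b)              ≡⟨ toℕ-idx {k} (p + dist a b) ⟩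
    (p + (toℕ b + M ∸ p) % M) % M   ≡⟨ cong (_% M) (+-comm p _) ⟩
    ((toℕ b + M ∸ p) % M + p) % M   ≡⟨ [m%d+n]%d≡[m+n]%d (toℕ b + M ∸ p) p M ⟩
    (toℕ b + M ∸ p + p) % M         ≡⟨ cong (_% M) (trans (+-comm _ p) (m+[n∸m]≡n p≤b+M)) ⟩
    (toℕ b + M) % M                 ≡⟨ [m+n]%n≡m%n (toℕ b) M ⟩
    toℕ b % M                       ≡⟨ m<n⇒m%n≡m (toℕ<n b) ⟩
    toℕ b                           ∎)
    where
    open ≡-Reasoning
    p≤b+M : p ≤ toℕ b + M
    p≤b+M = ≤-trans (<⇒≤ (toℕ<n a)) (m≤n+m M (toℕ b))

  ⊕-injective : ∀ {u v} → u < M → v < M → a ⊕ u ≡ a ⊕ v → u ≡ v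
  ⊕-injective u<M v<M eq = trans (sym (dist-⊕ u<M)) (trans (cong (dist a) eq) (dist-⊕ v<M))

module _ {n} (G : Graph n) where

  closedWalk⇒adj-next : ∀ {w vs} → Linked (Adj G) (w ∷ vs) → Connected (Adj G) (last (w ∷ vs)) (just w) →
    ∀ i → Adj G (lookup (w ∷ vs) i) (lookup (w ∷ vs) (next i))
  closedWalk⇒adj-next {w} {vs} linked closed i with m≤n⇒m<n∨m≡n (≤-pred (toℕ<n i))
  ... | inj₁ i<L = Linked⇒lookup-suc linked i (next i)
                     (trans (toℕ-idx {length vs} (suc (toℕ i))) (m<n⇒m%n≡m (s≤s i<L)))
  ... | inj₂ i≡L = subst (Adj G (lookup (w ∷ vs) i) ∘ lookup (w ∷ vs)) (sym next-i≡0)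
                     (just⁻¹ (subst (λ m → Connected (Adj G) m (just w)) (last-lookup i (cong suc i≡L)) closed))
    where
    next-i≡0 : next i ≡ zero
    next-i≡0 = toℕ-injective (trans (toℕ-idx {length vs} (suc (toℕ i)))
                 (trans (cong (λ t → suc t % suc (length vs)) i≡L) (n%n≡0 (suc (length vs)))))
    just⁻¹ : ∀ {u v} → Connected (Adj G) (just u) (just v) → Adj G u v
    just⁻¹ (just r) = r

  cycleOf : ∀ w vs → 2 ≤ length vs → Unique (w ∷ vs) →
    Linked (Adj G) (w ∷ vs) → Connected (Adj G) (last (w ∷ vs)) (just w) → Cycle G
  cycleOf w vs 2≤L unique linked closed = record
    { k   = length vs
    ; 2≤k = 2≤L
    ; vtx = lookup (w ∷ vs)
    ; inj = Unique⇒lookup-injective unique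
    ; adj = closedWalk⇒adj-next linked closed
    }

  Longest⇒no-longer-HamiltonianCycle : ∀ {C vs} → Longest G C → Unique vs → len C < length vs →
    ¬ HamiltonianCycle (Adj G) vs
  Longest⇒no-longer-HamiltonianCycle {C} longest unique-vs C<vs H =
    <⇒≱ C<order (bound order (≤-trans (s≤s (2≤k C)) (<⇒≤ C<order)) unique-order linked closed)
    where
    open HamiltonianCycle H
    C<order : len C < length order
    C<order = subst (len C <_) (sym (↭-length order↭)) C<vs
    unique-order : Unique order
    unique-order = Unique-resp-↭ (setoid _) (↭⇒↭ₛ (↭-sym order↭)) unique-vs
    bound : ∀ ws → 3 ≤ length ws → Unique ws → Linked (Adj G) ws → Connected (Adj G) (last ws) (head ws) →
      length ws ≤ len C
    bound (w ∷ vs) (s≤s 2≤L) u l c = longest (cycleOf w vs 2≤L u l c)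

module _ {n} {G : Graph n} (C : Cycle G) (a : Fin (len C)) where

  around : ℕ → Fin n
  around u = vtx C (a ⊕ u)

  around-zero : around 0 ≡ vtx C a
  around-zero = cong (vtx C) (⊕-zero a)

  around-dist : ∀ b → around (dist a b) ≡ vtx C b
  around-dist b = cong (vtx C) (⊕-dist a b)

  around-next : ∀ u → vtx C (next (a ⊕ u)) ≡ around (suc u)
  around-next u = cong (vtx C) (next-⊕ a u)

  around-next-dist : ∀ b → vtx C (next b) ≡ around (suc (dist a b))
  around-next-dist b = trans (cong (vtx C ∘ next) (sym (⊕-dist a b))) (around-next (dist a b))

  around-step : ∀ u → Adj G (around u) (around (suc u))
  around-step u = subst (Adj G (around u)) (around-next u) (adj C (a ⊕ u))

  Unique[outside∷around] : ∀ {x} → (∀ i → x ≢ vtx C i) → Unique (x ∷ arc around 0 (len C))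
  Unique[outside∷around] x∉C = All.applyUpTo⁺₂ around (len C) (x∉C ∘ (a ⊕_))
    ∷ Unique.applyUpTo⁺₁ around (len C)
        (λ i<j j<M → <⇒≢ i<j ∘ ⊕-injective a (<-trans i<j j<M) j<M ∘ inj C)

lemma2p4 : ∀ {n} (G : Graph n) (C : Cycle G) → Longest G C →
    (x : Fin n) → (∀ i → x ≢ vtx C i) → (∀ y → Adj G x y → OnCycle C y) →
    (a b : Fin (len C)) → Adj G x (vtx C a) → Adj G x (vtx C b) → a ≢ b →
    (s : Fin (len C)) → OnPath a b s → OnPath a b (next s) → s ≢ b →
    ¬ (Adj G (vtx C s) (vtx C (prev a)) × Adj G (vtx C (next s)) (vtx C (next b)))
    × ¬ (Adj G (vtx C s) (vtx C (next b)) × Adj G (vtx C (next s)) (vtx C (prev a)))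
lemma2p4 G C longest x x∉C _ a b x~a x~b _ _ (e , e≤d , refl) _ s≢b = no-reversal , no-swap
  where
  f : ℕ → Fin _
  f = around C a
  d : ℕ
  d = dist a b
  open Rerouting {R = Adj G} (Adj-sym G) f (around-step C a) (subst (Adj G x) (sym (around-zero C a)) x~a)

  no-tour : ¬ HamiltonianCycle (Adj G) (x ∷ arc f 0 (len C))
  no-tour = Longest⇒no-longer-HamiltonianCycle G {C} longest (Unique[outside∷around] C a x∉C)
    (s≤s (≤-reflexive (sym (length-applyUpTo f (len C)))))

  x~fd : Adj G x (f d)
  x~fd = subst (Adj G x) (sym (around-dist C a b)) x~b

  d<K : d < k C
  d<K = ≤∧≢⇒< (≤-pred (m%n<n (toℕ b + len C ∸ toℕ a) (len C)))
    (λ d≡K → no-tour (insertion (subst (Adj G x ∘ f) d≡K x~fd)))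

  e<d : e < d
  e<d = ≤∧≢⇒< e≤d (λ e≡d → s≢b (trans (cong (a ⊕_) e≡d) (⊕-dist a b)))

  no-reversal : ¬ (Adj G (f e) (vtx C (prev a)) × Adj G (vtx C (next (a ⊕ e))) (vtx C (next b)))
  no-reversal (s~a⁻ , s⁺~b⁺) =
    no-tour (reversing e<d d<K x~fd s~a⁻ (subst₂ (Adj G) (around-next C a e) (around-next-dist C a b) s⁺~b⁺))

  no-swap : ¬ (Adj G (f e) (vtx C (next b)) × Adj G (vtx C (next (a ⊕ e))) (vtx C (prev a)))
  no-swap (s~b⁺ , s⁺~a⁻) =
    no-tour (swapping e<d d<K x~fd (subst (Adj G (f e)) (around-next-dist C a b) s~b⁺)
                                   (subst (λ v → Adj G v (f (k C))) (around-next C a e) s⁺~a⁻))
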